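{- If $G$ is a finite simple graph with minimum degree $\delta(G)\ge 7$, then $\mathrm{Maj}'(G)\le 4$.
   Context: Two distinct edges are adjacent if they share an endpoint. An edge-coloring $c:E\to C$ (not necessarily proper) of a graph $G=(V,E)$ is a strong majority edge-coloring if for every edge $e\in E$ and every color $\alpha\in C$, at most half of the edges adjacent to $e$ have color $\alpha$. The strong majority index $\mathrm{Maj}'(G)$ is the least number of colors in such a coloring. -}

module Defs where

open import Data.Bool using (Bool; true; false; _∧_; _∨_; not)
open import Data.Nat using (ℕ; _*_; _≤_)
open import Data.Fin using (Fin; toℕ)
open import Data.Fin.Properties using (_≟_)
open import Data.Nat.Properties using (_<?_)
open import Data.List using (List; length; filterᵇ; concatMap; map)
open import Data.List using () renaming (allFin to allFinL)
open import Data.Product using (_×_; _,_)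
open import Relation.Nullary.Decidable using (⌊_⌋)
open import Relation.Binary.PropositionalEquality using (_≡_)

record Graph : Set where
  field
    n     : ℕ
    adj   : Fin n → Fin n → Bool
    sym   : ∀ u v → adj u v ≡ adj v u
    irrefl : ∀ v → adj v v ≡ false
open Graph public

_==_ : ∀ {m} → Fin m → Fin m → Bool
a == b = ⌊ a ≟ b ⌋

module _ (G : Graph) where
  private
    V = Fin (n G)

  degree : V → ℕ
  degree v = length (filterᵇ (adj G v) (allFinL (n G)))

  MinDegreeAtLeast : ℕ → Set
  MinDegreeAtLeast d = ∀ v → d ≤ degree v

  -- an (unordered) edge {x,y} is represented by the ordered pair (x , y), x < y
  orderedPairs : List (V × V)
  orderedPairs =
    concatMap (λ x → map (λ y → (x , y))
                 (filterᵇ (λ y → ⌊ toℕ x <? toℕ y ⌋) (allFinL (n G))))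
              (allFinL (n G))

  isEdge : V × V → Bool
  isEdge (x , y) = adj G x y

  edges : List (V × V)
  edges = filterᵇ isEdge orderedPairs

  adjacentᵇ : V × V → V × V → Bool
  adjacentᵇ (x , y) (u , v) =
    not ((x == u) ∧ (y == v)) ∧ ((x == u) ∨ (x == v) ∨ (y == u) ∨ (y == v))

  adjacentEdges : V × V → List (V × V)
  adjacentEdges e = filterᵇ (adjacentᵇ e) edges

  -- an edge-colouring with k colours assigns to the edge {x,y} (x < y) the
  -- colour c x y; values of c on other pairs are irrelevant.
  EdgeColouring : ℕ → Set
  EdgeColouring k = V → V → Fin k

  colourOf : ∀ {k} → EdgeColouring k → V × V → Fin k
  colourOf c (x , y) = c x y

  IsStrongMajority : ∀ {k} → EdgeColouring k → Set
  IsStrongMajority {k} c =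
    ∀ (x y : V) → isEdge (x , y) ≡ true → toℕ x Data.Nat.< toℕ y →
    ∀ (α : Fin k) →
      2 * length (filterᵇ (λ f → colourOf c f == α) (adjacentEdges (x , y)))
        ≤ length (adjacentEdges (x , y))

  MajIndexAtMost : ℕ → Set
  MajIndexAtMost k = Data.Product.Σ (EdgeColouring k) IsStrongMajority

{-# OPTIONS --safe #-}
-- Every multigraph has an orientation in which in- and out-degree differ by at
-- most one at every vertex: pair up the edges at a vertex v, splice each pair
-- u₁v, vu₂ into one edge u₁u₂, orient the smaller multigraph by induction and
-- route each spliced edge back through v.  Orienting the bipartite double cover
-- of G this way and colouring every edge by the side of its tail gives a
-- 2-colouring in which a vertex of degree d meets at most (d + 2)/2 edges of
-- each colour; 2-colouring each colour class again gives a 4-colouring with at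
-- most (d + 6)/4 edges of each colour at v.  For d ≥ 7 this is less than d/2,
-- and as an edge xy has d(x) + d(y) − 2 neighbours, at most half of them share
-- a colour.
module Submission where

open import Defs hiding (sym)

open import Data.Bool using (Bool; true; false; _∧_; _∨_; not; if_then_else_)
open import Data.Empty using (⊥-elim)
open import Data.Fin using (Fin; zero; suc; toℕ; combine; remQuot)
import Data.Fin.Properties as Fin
open import Data.List using (List; []; _∷_; _++_; map; length; filterᵇ; concatMap; allFin)
open import Data.List.Membership.Propositional using (_∈_)
open import Data.List.Membership.Propositional.Properties using (∈-map⁻; ∈-allFin)
open import Data.List.Properties using (map-++; map-∘; map-cong)
open import Data.List.Relation.Binary.Disjoint.Propositional using (Disjoint)
open import Data.List.Relation.Binary.Permutation.Propositional as Perm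
  using (_↭_; ↭-refl; ↭-prep; ↭-swap; ↭-trans; ↭-sym)
import Data.List.Relation.Binary.Permutation.Propositional.Properties as ↭
open import Data.List.Relation.Binary.Pointwise as Pointwise using (Pointwise; []; _∷_)
open import Data.List.Relation.Unary.All using (All; []; _∷_)
import Data.List.Relation.Unary.All as All
import Data.List.Relation.Unary.All.Properties as All
import Data.List.Relation.Unary.AllPairs as AllPairs
import Data.List.Relation.Unary.AllPairs.Properties as AllPairs
open import Data.List.Relation.Unary.Any using (here; there)
open import Data.List.Relation.Unary.Unique.Propositional using (Unique; []; _∷_)
import Data.List.Relation.Unary.Unique.Propositional.Properties as Unique
open import Data.Nat using (ℕ; zero; suc; _+_; _*_; _≤_; _<_; z≤n; s≤s)
open import Data.Nat.ListAction using (sum)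
open import Data.Nat.ListAction.Properties using (sum-++; sum-↭)
open import Data.Nat.Properties
open import Algebra.Properties.CommutativeSemigroup +-commutativeSemigroup using (interchange; x∙yz≈y∙xz)
open import Data.Product using (_×_; _,_; proj₁; proj₂; swap; ∃-syntax; ∃₂)
import Data.Product.Properties as ×
open import Data.Sum using (_⊎_; inj₁; inj₂)
import Data.Sum.Properties as ⊎
open import Function using (_∘_; id; case_of_)
open import Relation.Binary.Definitions using (DecidableEquality)
open import Relation.Binary.PropositionalEquality
open import Relation.Nullary.Decidable using (Dec; yes; no; ⌊_⌋; T?; toWitness; isYes≗does; dec-false; ⌊⌋-map′)
open import Relation.Nullary.Negation using (contradiction)

𝟙 : Bool → ℕ
𝟙 true  = 1
𝟙 false = 0

∑ : {A : Set} → List A → (A → ℕ) → ℕ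
∑ xs f = sum (map f xs)

infix 5 ∑
syntax ∑ xs (λ x → e) = ∑[ x ∈ xs ] e

module _ {A : Set} where

  ∑-++ : ∀ xs ys (f : A → ℕ) → ∑ (xs ++ ys) f ≡ ∑ xs f + ∑ ys f
  ∑-++ xs ys f = trans (cong sum (map-++ f xs ys)) (sum-++ (map f xs) (map f ys))

  ∑-↭ : ∀ {xs ys} (f : A → ℕ) → xs ↭ ys → ∑ xs f ≡ ∑ ys f
  ∑-↭ f xs↭ys = sum-↭ (↭.map⁺ f xs↭ys)

  ∑-+ : ∀ xs (f g : A → ℕ) → ∑[ x ∈ xs ] (f x + g x) ≡ ∑ xs f + ∑ xs g
  ∑-+ []       f g = refl
  ∑-+ (x ∷ xs) f g = trans (cong (f x + g x +_) (∑-+ xs f g))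
                           (interchange (f x) (g x) _ _)

  ∑-mono-≤ : ∀ {xs} {f g : A → ℕ} → All (λ x → f x ≤ g x) xs → ∑ xs f ≤ ∑ xs g
  ∑-mono-≤ []         = z≤n
  ∑-mono-≤ (fx≤gx ∷ h) = +-mono-≤ fx≤gx (∑-mono-≤ h)

  ∑-cong : ∀ xs {f g : A → ℕ} → (∀ x → f x ≡ g x) → ∑ xs f ≡ ∑ xs g
  ∑-cong xs f≗g = cong sum (map-cong f≗g xs)

  ∑-*ˡ : ∀ m xs (f : A → ℕ) → ∑[ x ∈ xs ] m * f x ≡ m * ∑ xs f
  ∑-*ˡ m []       f = sym (*-zeroʳ m)
  ∑-*ˡ m (x ∷ xs) f = trans (cong (m * f x +_) (∑-*ˡ m xs f)) (sym (*-distribˡ-+ m (f x) _))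

  ∈⇒≤∑ : ∀ {x xs} (f : A → ℕ) → x ∈ xs → f x ≤ ∑ xs f
  ∈⇒≤∑ f (here refl) = m≤m+n _ _
  ∈⇒≤∑ f (there x∈xs) = ≤-trans (∈⇒≤∑ f x∈xs) (m≤n+m _ _)

  ∑-filterᵇ : ∀ (p : A → Bool) xs (f : A → ℕ) → ∑ (filterᵇ p xs) f ≡ ∑[ x ∈ xs ] 𝟙 (p x) * f x
  ∑-filterᵇ p []       f = refl
  ∑-filterᵇ p (x ∷ xs) f with p x
  ... | true  = cong₂ _+_ (sym (+-identityʳ (f x))) (∑-filterᵇ p xs f)
  ... | false = ∑-filterᵇ p xs f

  length-filterᵇ : ∀ (p : A → Bool) xs → length (filterᵇ p xs) ≡ ∑[ x ∈ xs ] 𝟙 (p x)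
  length-filterᵇ p []       = refl
  length-filterᵇ p (x ∷ xs) with p x
  ... | true  = cong suc (length-filterᵇ p xs)
  ... | false = length-filterᵇ p xs

  filterᵇ-comm : ∀ (p q : A → Bool) xs → filterᵇ p (filterᵇ q xs) ≡ filterᵇ q (filterᵇ p xs)
  filterᵇ-comm p q []       = refl
  filterᵇ-comm p q (x ∷ xs) with p x in px | q x in qx
  ... | true  | true  rewrite px | qx = cong (x ∷_) (filterᵇ-comm p q xs)
  ... | true  | false rewrite qx      = filterᵇ-comm p q xs
  ... | false | true  rewrite px      = filterᵇ-comm p q xs
  ... | false | false                 = filterᵇ-comm p q xs

  ∑-𝟙-unique : ∀ (p : A → Bool) → (∀ {x y} → p x ≡ true → p y ≡ true → x ≡ y) →
               ∀ {xs} → Unique xs → ∑[ x ∈ xs ] 𝟙 (p x) ≤ 1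
  ∑-𝟙-unique p p-unique []               = z≤n
  ∑-𝟙-unique p p-unique {x ∷ xs} (x∉xs ∷ unique) with p x in px
  ... | false = ∑-𝟙-unique p p-unique unique
  ... | true  = s≤s (≤-reflexive (∑-none xs x∉xs))
    where
    ∑-none : ∀ ys → All (x ≢_) ys → ∑[ y ∈ ys ] 𝟙 (p y) ≡ 0
    ∑-none []       []            = refl
    ∑-none (y ∷ ys) (x≢y ∷ x∉ys) with p y in py
    ... | true  = contradiction (p-unique px py) x≢y
    ... | false = ∑-none ys x∉ys

  module _ {B : Set} where

    ∑-map : ∀ (g : B → A) xs (f : A → ℕ) → ∑ (map g xs) f ≡ ∑ xs (f ∘ g)
    ∑-map g xs f = cong sum (sym (map-∘ xs))

    ∑-concatMap : ∀ (g : B → List A) xs (f : A → ℕ) → ∑ (concatMap g xs) f ≡ ∑[ y ∈ xs ] ∑ (g y) f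
    ∑-concatMap g []       f = refl
    ∑-concatMap g (y ∷ xs) f = trans (∑-++ (g y) (concatMap g xs) f) (cong (∑ (g y) f +_) (∑-concatMap g xs f))

+-mono-≤-suc : ∀ {a b c d} → a ≤ suc b → c ≤ suc d → a + c ≤ (b + d) + 2
+-mono-≤-suc {b = b} {d = d} a≤ c≤ =
  ≤-trans (+-mono-≤ a≤ c≤) (≤-reflexive (trans (cong suc (+-suc b d)) (+-comm 2 (b + d))))

≤+⇒2*≤ : ∀ {a b d s} → a ≤ b + s → a + b ≡ d → 2 * a ≤ d + s
≤+⇒2*≤ {a} {b} {d} {s} a≤ a+b≡d = begin
  2 * a        ≡⟨ cong (a +_) (+-identityʳ a) ⟩
  a + a        ≤⟨ +-monoʳ-≤ a a≤ ⟩
  a + (b + s)  ≡⟨ +-assoc a b s ⟨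
  a + b + s    ≡⟨ cong (_+ s) a+b≡d ⟩
  d + s        ∎
  where open ≤-Reasoning

4*≤+6⇒2*< : ∀ d {D} → 4 * d ≤ D + 6 → 7 ≤ D → 2 * d < D
4*≤+6⇒2*< d {D} 4d≤D+6 7≤D with 2 * d <? D
... | yes 2d<D = 2d<D
... | no 2d≮D = contradiction (+-cancelˡ-≤ D 7 6 (begin
  D + 7          ≤⟨ +-monoʳ-≤ D 7≤D ⟩
  D + D          ≤⟨ +-mono-≤ D≤2d D≤2d ⟩
  2 * d + 2 * d  ≡⟨ *-distribʳ-+ d 2 2 ⟨
  4 * d          ≤⟨ 4d≤D+6 ⟩
  D + 6          ∎)) (<-irrefl refl)
  where
  open ≤-Reasoning
  D≤2d : D ≤ 2 * d
  D≤2d = ≮⇒≥ 2d≮D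

2*≤-from-halves : ∀ {A} a b {Dₐ D_b B} →
                  A ≤ a + b → 2 * a < Dₐ → 2 * b < D_b → Dₐ + D_b ≤ B + 2 → 2 * A ≤ B
2*≤-from-halves {A} a b {Dₐ} {D_b} {B} A≤a+b 2a<Dₐ 2b<D_b Dₐ+D_b≤B+2 = +-cancelʳ-≤ 2 (2 * A) B (begin
  2 * A + 2                    ≤⟨ +-monoˡ-≤ 2 (*-monoʳ-≤ 2 A≤a+b) ⟩
  2 * (a + b) + 2              ≡⟨ cong (_+ 2) (*-distribˡ-+ 2 a b) ⟩
  2 * a + 2 * b + 2            ≡⟨ +-assoc (2 * a) (2 * b) 2 ⟩
  2 * a + (2 * b + 2)          ≡⟨ cong (2 * a +_) (+-comm (2 * b) 2) ⟩
  2 * a + suc (suc (2 * b))    ≡⟨ +-suc (2 * a) (suc (2 * b)) ⟩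
  suc (2 * a) + suc (2 * b)    ≤⟨ +-mono-≤ 2a<Dₐ 2b<D_b ⟩
  Dₐ + D_b                     ≤⟨ Dₐ+D_b≤B+2 ⟩
  B + 2                        ∎)
  where open ≤-Reasoning

module _ {A B : Set} {R : A → B → Set} where

  Pointwise-↭ : ∀ {xs ys zs} → xs ↭ ys → Pointwise R ys zs → ∃[ ws ] Pointwise R xs ws × ws ↭ zs
  Pointwise-↭ Perm.refl           rs            = _ , rs , ↭-refl
  Pointwise-↭ (Perm.prep x p)     (r ∷ rs)      with _ , rs′ , q ← Pointwise-↭ p rs = _ , r ∷ rs′ , ↭-prep _ q
  Pointwise-↭ (Perm.swap x y p)   (r ∷ r′ ∷ rs)
    with _ , rs′ , q ← Pointwise-↭ p rs = _ , r′ ∷ r ∷ rs′ , ↭-swap _ _ q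
  Pointwise-↭ (Perm.trans p₁ p₂)  rs
    with _ , rs₂ , q₂ ← Pointwise-↭ p₂ rs
    with _ , rs₁ , q₁ ← Pointwise-↭ p₁ rs₂ = _ , rs₁ , ↭-trans q₁ q₂

  Pointwise-++⁻ : ∀ xs {ys zs} → Pointwise R (xs ++ ys) zs →
                  ∃₂ λ zs₁ zs₂ → zs ≡ zs₁ ++ zs₂ × Pointwise R xs zs₁ × Pointwise R ys zs₂
  Pointwise-++⁻ []       rs       = [] , _ , refl , [] , rs
  Pointwise-++⁻ (x ∷ xs) (r ∷ rs)
    with _ , _ , refl , rs₁ , rs₂ ← Pointwise-++⁻ xs rs = _ , _ , refl , r ∷ rs₁ , rs₂

module DecEqᵇ {A : Set} (_≟_ : DecidableEquality A) where

  _=ᵇ_ : A → A → Bool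
  a =ᵇ b = ⌊ a ≟ b ⌋

  ≡⇒=ᵇ : ∀ {a b} → a ≡ b → (a =ᵇ b) ≡ true
  ≡⇒=ᵇ refl = cong ⌊_⌋ (≡-≟-identity _≟_ refl)

  ≢⇒¬=ᵇ : ∀ {a b} → a ≢ b → (a =ᵇ b) ≡ false
  ≢⇒¬=ᵇ {a} {b} a≢b = trans (isYes≗does (a ≟ b)) (dec-false (a ≟ b) a≢b)

module Orientations {V : Set} (_≟_ : DecidableEquality V) where

  open DecEqᵇ _≟_ public

  Edge : Set
  Edge = V × V

  outdeg indeg : V → List Edge → ℕ
  outdeg v O = ∑[ e ∈ O ] 𝟙 (v =ᵇ proj₁ e)
  indeg  v O = ∑[ e ∈ O ] 𝟙 (v =ᵇ proj₂ e)

  BalancedAt : V → List Edge → Set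
  BalancedAt v O = outdeg v O ≤ suc (indeg v O) × indeg v O ≤ suc (outdeg v O)

  _≈ᵘ_ : Edge → Edge → Set
  e ≈ᵘ f = f ≡ e ⊎ f ≡ swap e

  -- O is an orientation of L when L ≋ᵘ O.
  _≋ᵘ_ : List Edge → List Edge → Set
  _≋ᵘ_ = Pointwise _≈ᵘ_

  ≈ᵘ-trans : ∀ {e f g} → e ≈ᵘ f → f ≈ᵘ g → e ≈ᵘ g
  ≈ᵘ-trans (inj₁ refl) f≈g         = f≈g
  ≈ᵘ-trans (inj₂ refl) (inj₁ refl) = inj₂ refl
  ≈ᵘ-trans (inj₂ refl) (inj₂ refl) = inj₁ refl

  ≋ᵘ-refl : ∀ {L} → L ≋ᵘ L
  ≋ᵘ-refl = Pointwise.refl (inj₁ refl)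

  ≋ᵘ-trans : ∀ {L M N} → L ≋ᵘ M → M ≋ᵘ N → L ≋ᵘ N
  ≋ᵘ-trans = Pointwise.transitive ≈ᵘ-trans

  HasBalancedOrientation : List V → List Edge → Set
  HasBalancedOrientation vs L = ∃[ O ] L ≋ᵘ O × All (λ v → BalancedAt v O) vs

  BalancedAt-↭ : ∀ {v O O′} → O ↭ O′ → BalancedAt v O → BalancedAt v O′
  BalancedAt-↭ {v} O↭O′
    rewrite ∑-↭ (λ e → 𝟙 (v =ᵇ proj₁ e)) O↭O′ | ∑-↭ (λ e → 𝟙 (v =ᵇ proj₂ e)) O↭O′ = id

  BalancedAt-++ : ∀ {v} O {Q} → BalancedAt v O → outdeg v Q ≡ indeg v Q → BalancedAt v (O ++ Q)
  BalancedAt-++ {v} O {Q} (out≤ , in≤) out≡in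
    rewrite ∑-++ O Q (λ e → 𝟙 (v =ᵇ proj₁ e)) | ∑-++ O Q (λ e → 𝟙 (v =ᵇ proj₂ e)) | out≡in =
    +-monoˡ-≤ (indeg v Q) out≤ , +-monoˡ-≤ (indeg v Q) in≤

  _∼_ : List Edge → List Edge → Set
  L ∼ M = ∃[ L′ ] L ≋ᵘ L′ × L′ ↭ M

  HasBalancedOrientation-∼ : ∀ {vs L M} → L ∼ M → HasBalancedOrientation vs M → HasBalancedOrientation vs L
  HasBalancedOrientation-∼ (L′ , L≋L′ , L′↭M) (O , M≋O , balanced)
    with O′ , L′≋O′ , O′↭O ← Pointwise-↭ L′↭M M≋O =
    O′ , ≋ᵘ-trans L≋L′ L′≋O′ , All.map (BalancedAt-↭ (↭-sym O′↭O)) balanced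

  Neutral : V → Edge → Set
  Neutral v (a , b) = (v =ᵇ a) ≡ (v =ᵇ b)

  Neutral⇒out≡in : ∀ {v R Q} → All (Neutral v) R → R ≋ᵘ Q → outdeg v Q ≡ indeg v Q
  Neutral⇒out≡in []         []                 = refl
  Neutral⇒out≡in (n ∷ ns)   (inj₁ refl ∷ R≋Q) = cong₂ _+_ (cong 𝟙 n) (Neutral⇒out≡in ns R≋Q)
  Neutral⇒out≡in (n ∷ ns)   (inj₂ refl ∷ R≋Q) = cong₂ _+_ (cong 𝟙 (sym n)) (Neutral⇒out≡in ns R≋Q)

  Separation : V → List Edge → Set
  Separation v L = ∃₂ λ us R → L ∼ (map (v ,_) us ++ R) × All (v ≢_) us × All (Neutral v) R

  separate : ∀ v L → Separation v L
  separate v [] = [] , [] , ([] , [] , ↭-refl) , [] , []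
  separate v ((a , b) ∷ L) with us , R , (L′ , L≋L′ , L′↭) , v≢us , neutral ← separate v L =
    classify (v ≟ a) (v ≟ b)
    where
    keep : Neutral v (a , b) → Separation v ((a , b) ∷ L)
    keep n = us , (a , b) ∷ R
           , (_ , inj₁ refl ∷ L≋L′ , ↭-trans (↭-prep _ L′↭) (↭-sym (↭.shift (a , b) (map (v ,_) us) R)))
           , v≢us , n ∷ neutral
    classify : Dec (v ≡ a) → Dec (v ≡ b) → Separation v ((a , b) ∷ L)
    classify (yes v≡a) (no v≢b)  =
      b ∷ us , R , (_ , inj₁ (cong (_, b) v≡a) ∷ L≋L′ , ↭-prep _ L′↭) , v≢b ∷ v≢us , neutral
    classify (no v≢a)  (yes v≡b) =
      a ∷ us , R , (_ , inj₂ (cong (_, a) v≡b) ∷ L≋L′ , ↭-prep _ L′↭) , v≢a ∷ v≢us , neutral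
    classify (yes v≡a) (yes v≡b) = keep (trans (≡⇒=ᵇ v≡a) (sym (≡⇒=ᵇ v≡b)))
    classify (no v≢a)  (no v≢b)  = keep (trans (≢⇒¬=ᵇ v≢a) (sym (≢⇒¬=ᵇ v≢b)))

  pairUp : V → List V → List Edge
  pairUp v []             = []
  pairUp v (u ∷ [])       = (v , u) ∷ []
  pairUp v (u₁ ∷ u₂ ∷ us) = (u₁ , u₂) ∷ pairUp v us

  AgreeAwayFrom : V → List Edge → List Edge → Set
  AgreeAwayFrom v O P = ∀ u → u ≢ v → outdeg u O ≡ outdeg u P × indeg u O ≡ indeg u P

  Unpairing : V → List V → List Edge → Set
  Unpairing v us P = ∃[ O ] map (v ,_) us ≋ᵘ O × BalancedAt v O × AgreeAwayFrom v O P

  unpair : ∀ v us {P} → All (v ≢_) us → pairUp v us ≋ᵘ P → Unpairing v us P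
  unpair v [] [] [] = [] , [] , (z≤n , z≤n) , λ _ _ → refl , refl
  unpair v (u ∷ []) (v≢u ∷ []) (inj₁ refl ∷ []) = _ , inj₁ refl ∷ [] , balanced , λ _ _ → refl , refl
    where
    balanced : BalancedAt v ((v , u) ∷ [])
    balanced rewrite ≡⇒=ᵇ (refl {x = v}) | ≢⇒¬=ᵇ v≢u = s≤s z≤n , z≤n
  unpair v (u ∷ []) (v≢u ∷ []) (inj₂ refl ∷ []) = _ , inj₂ refl ∷ [] , balanced , λ _ _ → refl , refl
    where
    balanced : BalancedAt v ((u , v) ∷ [])
    balanced rewrite ≡⇒=ᵇ (refl {x = v}) | ≢⇒¬=ᵇ v≢u = z≤n , s≤s z≤n
  unpair v (u₁ ∷ u₂ ∷ us) {_ ∷ P} (v≢u₁ ∷ v≢u₂ ∷ v≢us) (inj₁ refl ∷ pairs≋P)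
    with O , star≋O , (out≤ , in≤) , agree ← unpair v us v≢us pairs≋P =
    (u₁ , v) ∷ (v , u₂) ∷ O , inj₂ refl ∷ inj₁ refl ∷ star≋O , balanced , agree′
    where
    balanced : BalancedAt v ((u₁ , v) ∷ (v , u₂) ∷ O)
    balanced rewrite ≡⇒=ᵇ (refl {x = v}) | ≢⇒¬=ᵇ v≢u₁ | ≢⇒¬=ᵇ v≢u₂ = s≤s out≤ , s≤s in≤
    agree′ : AgreeAwayFrom v ((u₁ , v) ∷ (v , u₂) ∷ O) ((u₁ , u₂) ∷ P)
    agree′ u u≢v rewrite ≢⇒¬=ᵇ u≢v =
      cong (𝟙 (u =ᵇ u₁) +_) (proj₁ (agree u u≢v)) , cong (𝟙 (u =ᵇ u₂) +_) (proj₂ (agree u u≢v))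
  unpair v (u₁ ∷ u₂ ∷ us) {_ ∷ P} (v≢u₁ ∷ v≢u₂ ∷ v≢us) (inj₂ refl ∷ pairs≋P)
    with O , star≋O , (out≤ , in≤) , agree ← unpair v us v≢us pairs≋P =
    (v , u₁) ∷ (u₂ , v) ∷ O , inj₁ refl ∷ inj₂ refl ∷ star≋O , balanced , agree′
    where
    balanced : BalancedAt v ((v , u₁) ∷ (u₂ , v) ∷ O)
    balanced rewrite ≡⇒=ᵇ (refl {x = v}) | ≢⇒¬=ᵇ v≢u₁ | ≢⇒¬=ᵇ v≢u₂ = s≤s out≤ , s≤s in≤
    agree′ : AgreeAwayFrom v ((v , u₁) ∷ (u₂ , v) ∷ O) ((u₂ , u₁) ∷ P)
    agree′ u u≢v rewrite ≢⇒¬=ᵇ u≢v =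
      cong (𝟙 (u =ᵇ u₂) +_) (proj₁ (agree u u≢v)) , cong (𝟙 (u =ᵇ u₁) +_) (proj₂ (agree u u≢v))

  AgreeAwayFrom-++ : ∀ {v} O P Q → AgreeAwayFrom v O P → AgreeAwayFrom v (O ++ Q) (P ++ Q)
  AgreeAwayFrom-++ O P Q agree u u≢v
    rewrite ∑-++ O Q (λ e → 𝟙 (u =ᵇ proj₁ e)) | ∑-++ O Q (λ e → 𝟙 (u =ᵇ proj₂ e))
          | ∑-++ P Q (λ e → 𝟙 (u =ᵇ proj₁ e)) | ∑-++ P Q (λ e → 𝟙 (u =ᵇ proj₂ e))
          | proj₁ (agree u u≢v) | proj₂ (agree u u≢v) = refl , refl

  balanced-orientation : ∀ vs L → HasBalancedOrientation vs L
  balanced-orientation []       L = L , ≋ᵘ-refl , []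
  balanced-orientation (v ∷ vs) L
    with us , R , L∼ , v≢us , R-neutral ← separate v L
    with O , pairs++R≋O , balanced ← balanced-orientation vs (pairUp v us ++ R)
    with P , Q , refl , pairs≋P , R≋Q ← Pointwise-++⁻ (pairUp v us) pairs++R≋O
    with O′ , star≋O′ , balanced-v , agree ← unpair v us v≢us pairs≋P =
    HasBalancedOrientation-∼ L∼
      (O′ ++ Q , Pointwise.++⁺ star≋O′ R≋Q , balanced-at-v ∷ All.map (λ {u} → transfer u) balanced)
    where
    balanced-at-v : BalancedAt v (O′ ++ Q)
    balanced-at-v = BalancedAt-++ O′ balanced-v (Neutral⇒out≡in R-neutral R≋Q)
    transfer : ∀ u → BalancedAt u (P ++ Q) → BalancedAt u (O′ ++ Q)
    transfer u balanced-u with u ≟ v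
    ... | yes refl = balanced-at-v
    ... | no u≢v
      with out≡ , in≡ ← AgreeAwayFrom-++ O′ P Q agree u u≢v
      rewrite out≡ | in≡ = balanced-u

module _ {A B : Set} (_≟_ : DecidableEquality A) where

  open DecEqᵇ _≟_

  lookupAssoc : B → List (A × B) → A → B
  lookupAssoc b₀ []             x = b₀
  lookupAssoc b₀ ((a , b) ∷ ps) x = if x =ᵇ a then b else lookupAssoc b₀ ps x

  lookupAssoc-∈ : ∀ b₀ ps → Unique (map proj₁ ps) → All (λ p → lookupAssoc b₀ ps (proj₁ p) ≡ proj₂ p) ps
  lookupAssoc-∈ b₀ []             []               = []
  lookupAssoc-∈ b₀ ((a , b) ∷ ps) (a∉ps ∷ unique) =
    head ∷ All.zipWith skip (All.map⁻ a∉ps , lookupAssoc-∈ b₀ ps unique)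
    where
    head : lookupAssoc b₀ ((a , b) ∷ ps) a ≡ b
    head rewrite ≡⇒=ᵇ (refl {x = a}) = refl
    skip : ∀ {p} → a ≢ proj₁ p × lookupAssoc b₀ ps (proj₁ p) ≡ proj₂ p →
           lookupAssoc b₀ ((a , b) ∷ ps) (proj₁ p) ≡ proj₂ p
    skip (a≢p , found) rewrite ≢⇒¬=ᵇ (a≢p ∘ sym) = found

combine-== : ∀ {m n} (a : Fin m) (b : Fin n) i j → (combine a b == combine i j) ≡ (a == i) ∧ (b == j)
combine-== a b i j with a Fin.≟ i | b Fin.≟ j | combine a b Fin.≟ combine i j
... | yes _    | yes _    | yes _ = refl
... | yes refl | yes refl | no ≢  = ⊥-elim (≢ refl)
... | no _     | _        | no _  = refl
... | no a≢i   | _        | yes ≡ = ⊥-elim (a≢i (Fin.combine-injectiveˡ a b i j ≡))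
... | yes _    | no _     | no _  = refl
... | yes _    | no b≢j   | yes ≡ = ⊥-elim (b≢j (Fin.combine-injectiveʳ a b i j ≡))

module Colourings {V : Set} (_≟_ : DecidableEquality V) where

  open Orientations _≟_ public

  ends : V → Edge → ℕ
  ends v (a , b) = 𝟙 (v =ᵇ a) + 𝟙 (v =ᵇ b)

  deg : V → List Edge → ℕ
  deg v L = ∑[ e ∈ L ] ends v e

  colourClass : ∀ {k} → (Edge → Fin k) → Fin k → List Edge → List Edge
  colourClass c α = filterᵇ (λ e → c e == α)

  EquitableAt : ∀ {k} → ℕ → (Edge → Fin k) → List Edge → V → Set
  EquitableAt {k} s c L v = ∀ α → k * deg v (colourClass c α L) ≤ deg v L + s

  deg-colourClasses₂ : ∀ v (c : Edge → Fin 2) L →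
                       deg v (colourClass c zero L) + deg v (colourClass c (suc zero) L) ≡ deg v L
  deg-colourClasses₂ v c []      = refl
  deg-colourClasses₂ v c (e ∷ L) with c e
  ... | zero     = trans (+-assoc (ends v e) _ _) (cong (ends v e +_) (deg-colourClasses₂ v c L))
  ... | suc zero = trans (x∙yz≈y∙xz (deg v (colourClass c zero L)) (ends v e) _)
                         (cong (ends v e +_) (deg-colourClasses₂ v c L))

  _≟ₑ_ : DecidableEquality Edge
  _≟ₑ_ = ×.≡-dec _≟_ _≟_

  private
    module Cover = Orientations (⊎.≡-dec _≟_ _≟_)

  lift : Edge → Cover.Edge
  lift (a , b) = inj₁ a , inj₂ b

  side : Cover.Edge → Fin 2
  side (inj₁ _ , _) = zero
  side (inj₂ _ , _) = suc zero

  paint : ∀ L {O} → map lift L Cover.≋ᵘ O → List (Edge × Fin 2)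
  paint []      []                  = []
  paint (e ∷ L) {o ∷ _} (_ ∷ L≋O) = (e , side o) ∷ paint L L≋O

  paint-edges : ∀ L {O} (L≋O : map lift L Cover.≋ᵘ O) → map proj₁ (paint L L≋O) ≡ L
  paint-edges []      []          = refl
  paint-edges (e ∷ L) (_ ∷ L≋O) = cong (e ∷_) (paint-edges L L≋O)

  inj₁-=ᵇ : ∀ u v → (inj₁ u Cover.=ᵇ inj₁ v) ≡ (u =ᵇ v)
  inj₁-=ᵇ u v = ⌊⌋-map′ _ _ (u ≟ v)

  inj₂-=ᵇ : ∀ u v → (inj₂ u Cover.=ᵇ inj₂ v) ≡ (u =ᵇ v)
  inj₂-=ᵇ u v = ⌊⌋-map′ _ _ (u ≟ v)

  Paints : (Edge → Fin 2) → ∀ L {O} → map lift L Cover.≋ᵘ O → Set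
  Paints c L L≋O = All (λ p → c (proj₁ p) ≡ proj₂ p) (paint L L≋O)

  deg-colourClass₀ : ∀ v {c} L {O} (L≋O : map lift L Cover.≋ᵘ O) → Paints c L L≋O →
                     deg v (colourClass c zero L) ≡ Cover.outdeg (inj₁ v) O + Cover.indeg (inj₂ v) O
  deg-colourClass₀ v []            []                  []               = refl
  deg-colourClass₀ v ((a , b) ∷ L) {_ ∷ O} (inj₁ refl ∷ L≋O) (c≡₀ ∷ paints)
    rewrite c≡₀ | inj₁-=ᵇ v a | inj₂-=ᵇ v b | deg-colourClass₀ v L L≋O paints =
    interchange (𝟙 (v =ᵇ a)) (𝟙 (v =ᵇ b)) (Cover.outdeg (inj₁ v) O) (Cover.indeg (inj₂ v) O)
  deg-colourClass₀ v ((a , b) ∷ L) (inj₂ refl ∷ L≋O) (c≡₁ ∷ paints)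
    rewrite c≡₁ = deg-colourClass₀ v L L≋O paints

  deg-colourClass₁ : ∀ v {c} L {O} (L≋O : map lift L Cover.≋ᵘ O) → Paints c L L≋O →
                     deg v (colourClass c (suc zero) L) ≡ Cover.indeg (inj₁ v) O + Cover.outdeg (inj₂ v) O
  deg-colourClass₁ v []            []                  []               = refl
  deg-colourClass₁ v ((a , b) ∷ L) (inj₁ refl ∷ L≋O) (c≡₀ ∷ paints)
    rewrite c≡₀ = deg-colourClass₁ v L L≋O paints
  deg-colourClass₁ v ((a , b) ∷ L) {_ ∷ O} (inj₂ refl ∷ L≋O) (c≡₁ ∷ paints)
    rewrite c≡₁ | inj₁-=ᵇ v a | inj₂-=ᵇ v b | deg-colourClass₁ v L L≋O paints =
    interchange (𝟙 (v =ᵇ a)) (𝟙 (v =ᵇ b)) (Cover.indeg (inj₁ v) O) (Cover.outdeg (inj₂ v) O)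

  two-colouring : ∀ vs L → Unique L → ∃[ c ] All (EquitableAt 2 c L) vs
  two-colouring vs L unique
    with O , L≋O , balanced ← Cover.balanced-orientation (map inj₁ vs ++ map inj₂ vs) (map lift L) =
    c , All.zipWith equitable (All.map⁻ (All.++⁻ˡ (map inj₁ vs) balanced) ,
                               All.map⁻ (All.++⁻ʳ (map inj₁ vs) balanced))
    where
    c : Edge → Fin 2
    c = lookupAssoc _≟ₑ_ zero (paint L L≋O)
    paints : Paints c L L≋O
    paints = lookupAssoc-∈ _≟ₑ_ zero (paint L L≋O) (subst Unique (sym (paint-edges L L≋O)) unique)
    equitable : ∀ {v} → Cover.BalancedAt (inj₁ v) O × Cover.BalancedAt (inj₂ v) O → EquitableAt 2 c L v
    equitable {v} ((out₁≤ , in₁≤) , (out₂≤ , in₂≤)) = λ where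
        zero       → ≤+⇒2*≤ class₀≤ (deg-colourClasses₂ v c L)
        (suc zero) → ≤+⇒2*≤ class₁≤ (trans (+-comm (deg v (colourClass c (suc zero) L)) _) (deg-colourClasses₂ v c L))
      where
      class₀≤ : deg v (colourClass c zero L) ≤ deg v (colourClass c (suc zero) L) + 2
      class₀≤ rewrite deg-colourClass₀ v L L≋O paints | deg-colourClass₁ v L L≋O paints = +-mono-≤-suc out₁≤ in₂≤
      class₁≤ : deg v (colourClass c (suc zero) L) ≤ deg v (colourClass c zero L) + 2
      class₁≤ rewrite deg-colourClass₀ v L L≋O paints | deg-colourClass₁ v L L≋O paints = +-mono-≤-suc in₁≤ out₂≤

  refine : ∀ {m n} → (Edge → Fin m) → (Fin m → Edge → Fin n) → Edge → Fin (m * n)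
  refine c cs e = combine (c e) (cs (c e) e)

  colourClass-refine : ∀ {m n} c (cs : Fin m → Edge → Fin n) i j L →
                       colourClass (refine c cs) (combine i j) L ≡ colourClass (cs i) j (colourClass c i L)
  colourClass-refine c cs i j [] = refl
  colourClass-refine c cs i j (e ∷ L) rewrite combine-== (c e) (cs (c e) e) i j with c e Fin.≟ i
  ... | no _ = colourClass-refine c cs i j L
  ... | yes ce≡i rewrite ce≡i with cs i e == j
  ...   | true  = cong (e ∷_) (colourClass-refine c cs i j L)
  ...   | false = colourClass-refine c cs i j L

  EquitableAt-refine : ∀ {m n s t} {c : Edge → Fin m} {cs : Fin m → Edge → Fin n} {L v} →
                       EquitableAt s c L v → (∀ i → EquitableAt t (cs i) (colourClass c i L) v) →
                       EquitableAt (s + m * t) (refine c cs) L v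
  EquitableAt-refine {m} {n} {s} {t} {c} {cs} {L} {v} equitable equitables α =
    subst (λ α → m * n * deg v (colourClass (refine c cs) α L) ≤ deg v L + (s + m * t))
          (Fin.combine-remQuot {m} n α) (bound (proj₁ (remQuot {m} n α)) (proj₂ (remQuot {m} n α)))
    where
    bound : ∀ i j → m * n * deg v (colourClass (refine c cs) (combine i j) L) ≤ deg v L + (s + m * t)
    bound i j = begin
      m * n * deg v (colourClass (refine c cs) (combine i j) L)
        ≡⟨ cong (λ M → m * n * deg v M) (colourClass-refine c cs i j L) ⟩
      m * n * deg v (colourClass (cs i) j (colourClass c i L))
        ≡⟨ *-assoc m n _ ⟩
      m * (n * deg v (colourClass (cs i) j (colourClass c i L)))
        ≤⟨ *-monoʳ-≤ m (equitables i j) ⟩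
      m * (deg v (colourClass c i L) + t)
        ≡⟨ *-distribˡ-+ m _ t ⟩
      m * deg v (colourClass c i L) + m * t
        ≤⟨ +-monoˡ-≤ (m * t) (equitable i) ⟩
      deg v L + s + m * t
        ≡⟨ +-assoc (deg v L) s (m * t) ⟩
      deg v L + (s + m * t) ∎
      where open ≤-Reasoning

  four-colouring : ∀ vs L → Unique L → ∃[ c ] All (EquitableAt 6 c L) vs
  four-colouring vs L unique with c , equitable ← two-colouring vs L unique =
    refine c (proj₁ ∘ refinement) ,
    All.tabulate (λ v∈vs → EquitableAt-refine {L = L} (All.lookup equitable v∈vs)
                                                      (λ i → All.lookup (proj₂ (refinement i)) v∈vs))
    where
    refinement : ∀ i → ∃[ cᵢ ] All (EquitableAt 2 cᵢ (colourClass c i L)) vs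
    refinement i = two-colouring vs (colourClass c i L) (Unique.filter⁺ (T? ∘ λ e → c e == i) unique)

𝟙-adjacent : ∀ p b₁ b₂ b₃ b₄ → 𝟙 (not p ∧ (b₁ ∨ b₂ ∨ b₃ ∨ b₄)) ≤ (𝟙 b₁ + 𝟙 b₂) + (𝟙 b₃ + 𝟙 b₄)
𝟙-adjacent true  _     _     _     _     = z≤n
𝟙-adjacent false true  _     _     _     = s≤s z≤n
𝟙-adjacent false false true  _     _     = s≤s z≤n
𝟙-adjacent false false false true  _     = s≤s z≤n
𝟙-adjacent false false false false true  = s≤s z≤n
𝟙-adjacent false false false false false = z≤n

module EdgeCounting (G : Graph) where

  open Colourings (Fin._≟_ {n G}) public

  private
    V : Set
    V = Fin (n G)

    _<ᵇ_ : V → V → Bool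
    a <ᵇ b = ⌊ toℕ a <? toℕ b ⌋

    row : V → List Edge
    row a = map (a ,_) (filterᵇ (a <ᵇ_) (allFin (n G)))

  edges-unique : Unique (edges G)
  edges-unique = Unique.filter⁺ (T? ∘ isEdge G)
    (Unique.concat⁺ (All.map⁺ (All.universal row-unique (allFin (n G))))
                    (AllPairs.map⁺ (AllPairs.map rows-disjoint (Unique.allFin⁺ (n G)))))
    where
    row-unique : ∀ a → Unique (row a)
    row-unique a = Unique.map⁺ (cong proj₂) (Unique.filter⁺ (T? ∘ (a <ᵇ_)) (Unique.allFin⁺ (n G)))
    rows-disjoint : ∀ {a b} → a ≢ b → Disjoint (row a) (row b)
    rows-disjoint a≢b (e∈a , e∈b)
      with _ , _ , refl ← ∈-map⁻ _ e∈a | _ , _ , e≡ ← ∈-map⁻ _ e∈b = a≢b (cong proj₁ e≡)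

  edges-ordered : All (λ e → toℕ (proj₁ e) < toℕ (proj₂ e)) (edges G)
  edges-ordered = All.filter⁺ (T? ∘ isEdge G) (All.concat⁺ (All.map⁺ (All.universal row-ordered (allFin (n G)))))
    where
    row-ordered : ∀ a → All (λ e → toℕ (proj₁ e) < toℕ (proj₂ e)) (row a)
    row-ordered a = All.map⁺ (All.map toWitness (All.all-filter (T? ∘ (a <ᵇ_)) (allFin (n G))))

  ∑-edges : ∀ (f : Edge → ℕ) →
            ∑ (edges G) f ≡ ∑[ a ∈ allFin (n G) ] ∑[ b ∈ allFin (n G) ] 𝟙 (a <ᵇ b) * (𝟙 (adj G a b) * f (a , b))
  ∑-edges f = begin
    ∑ (edges G) f                                               ≡⟨ ∑-filterᵇ (isEdge G) (orderedPairs G) f ⟩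
    ∑[ e ∈ orderedPairs G ] 𝟙 (isEdge G e) * f e                ≡⟨ ∑-concatMap row (allFin (n G)) _ ⟩
    ∑[ a ∈ allFin (n G) ] ∑[ e ∈ row a ] 𝟙 (isEdge G e) * f e   ≡⟨ ∑-cong (allFin (n G)) per-row ⟩
    ∑[ a ∈ allFin (n G) ] ∑[ b ∈ allFin (n G) ] 𝟙 (a <ᵇ b) * (𝟙 (adj G a b) * f (a , b)) ∎
    where
    open ≡-Reasoning
    per-row : ∀ a → ∑[ e ∈ row a ] 𝟙 (isEdge G e) * f e
                  ≡ ∑[ b ∈ allFin (n G) ] 𝟙 (a <ᵇ b) * (𝟙 (adj G a b) * f (a , b))
    per-row a = trans (∑-map (a ,_) (filterᵇ (a <ᵇ_) (allFin (n G))) (λ e → 𝟙 (isEdge G e) * f e))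
                      (∑-filterᵇ (a <ᵇ_) (allFin (n G)) _)

  degree≤deg : ∀ v → degree G v ≤ deg v (edges G)
  degree≤deg v = begin
    degree G v                                           ≡⟨ length-filterᵇ (adj G v) (allFin (n G)) ⟩
    ∑[ z ∈ allFin (n G) ] 𝟙 (adj G v z)                    ≤⟨ ∑-mono-≤ (All.universal neighbour (allFin (n G))) ⟩
    ∑[ z ∈ allFin (n G) ] (asFirst v z + asSecond z v)    ≡⟨ ∑-+ (allFin (n G)) (asFirst v) (λ z → asSecond z v) ⟩
    ∑ (allFin (n G)) (asFirst v) + (∑[ a ∈ allFin (n G) ] asSecond a v)
      ≤⟨ +-mono-≤ (∈⇒≤∑ (λ a → ∑ (allFin (n G)) (asFirst a)) (∈-allFin v))
                  (∑-mono-≤ (All.universal (λ a → ∈⇒≤∑ (asSecond a) (∈-allFin v)) (allFin (n G)))) ⟩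
    (∑[ a ∈ allFin (n G) ] ∑ (allFin (n G)) (asFirst a)) + (∑[ a ∈ allFin (n G) ] ∑ (allFin (n G)) (asSecond a))
      ≡⟨ ∑-+ (allFin (n G)) _ _ ⟨
    ∑[ a ∈ allFin (n G) ] (∑ (allFin (n G)) (asFirst a) + ∑ (allFin (n G)) (asSecond a))
      ≡⟨ ∑-cong (allFin (n G)) (λ a → sym (∑-+ (allFin (n G)) (asFirst a) (asSecond a))) ⟩
    ∑[ a ∈ allFin (n G) ] ∑[ b ∈ allFin (n G) ] (asFirst a b + asSecond a b)
      ≡⟨ ∑-cong (allFin (n G)) (λ a → ∑-cong (allFin (n G)) (λ b → split a b)) ⟨
    ∑[ a ∈ allFin (n G) ] ∑[ b ∈ allFin (n G) ] 𝟙 (a <ᵇ b) * (𝟙 (adj G a b) * ends v (a , b))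
      ≡⟨ ∑-edges (ends v) ⟨
    deg v (edges G) ∎
    where
    open ≤-Reasoning
    asFirst asSecond : V → V → ℕ
    asFirst  a b = 𝟙 (a <ᵇ b) * (𝟙 (adj G a b) * 𝟙 (v =ᵇ a))
    asSecond a b = 𝟙 (a <ᵇ b) * (𝟙 (adj G a b) * 𝟙 (v =ᵇ b))
    split : ∀ a b → 𝟙 (a <ᵇ b) * (𝟙 (adj G a b) * ends v (a , b)) ≡ asFirst a b + asSecond a b
    split a b = trans (cong (𝟙 (a <ᵇ b) *_) (*-distribˡ-+ (𝟙 (adj G a b)) _ _)) (*-distribˡ-+ (𝟙 (a <ᵇ b)) _ _)
    neighbour : ∀ z → 𝟙 (adj G v z) ≤ asFirst v z + asSecond z v
    neighbour z rewrite ≡⇒=ᵇ (refl {x = v}) | Graph.sym G z v with adj G v z in v~z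
    ... | false = z≤n
    ... | true with toℕ v <? toℕ z | toℕ z <? toℕ v
    ...   | yes _ | _     = s≤s z≤n
    ...   | no _  | yes _ = s≤s z≤n
    ...   | no v≮z | no z≮v with refl ← Fin.toℕ-injective (≤-antisym (≮⇒≥ z≮v) (≮⇒≥ v≮z)) =
      case trans (sym v~z) (Graph.irrefl G v) of λ ()

  -- f = uw meets xy, with x < y and u < w, in at most one endpoint unless f = xy.
  ends≤adjacent : ∀ x y {f} → toℕ x < toℕ y → toℕ (proj₁ f) < toℕ (proj₂ f) →
                  ends x f + ends y f ≤ 𝟙 (adjacentᵇ G (x , y) f) + 2 * 𝟙 ((x == proj₁ f) ∧ (y == proj₂ f))
  ends≤adjacent x y {u , w} x<y u<w with x Fin.≟ u | x Fin.≟ w | y Fin.≟ u | y Fin.≟ w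
  ... | yes refl | yes refl | _        | _        = contradiction u<w (<-irrefl refl)
  ... | yes refl | no _     | yes refl | _        = contradiction x<y (<-irrefl refl)
  ... | yes refl | no _     | no _     | yes refl = ≤-refl
  ... | yes refl | no _     | no _     | no _     = ≤-refl
  ... | no _     | yes refl | _        | yes refl = contradiction x<y (<-irrefl refl)
  ... | no _     | yes refl | yes refl | no _     = contradiction x<y (<-asym u<w)
  ... | no _     | yes refl | no _     | no _     = ≤-refl
  ... | no _     | no _     | yes refl | yes refl = contradiction u<w (<-irrefl refl)
  ... | no _     | no _     | yes refl | no _     = ≤-refl
  ... | no _     | no _     | no _     | yes refl = ≤-refl
  ... | no _     | no _     | no _     | no _     = ≤-refl

  deg+deg≤adjacent : ∀ x y → toℕ x < toℕ y → deg x (edges G) + deg y (edges G) ≤ length (adjacentEdges G (x , y)) + 2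
  deg+deg≤adjacent x y x<y = begin
    deg x (edges G) + deg y (edges G)
      ≡⟨ ∑-+ (edges G) (ends x) (ends y) ⟨
    ∑[ f ∈ edges G ] (ends x f + ends y f)
      ≤⟨ ∑-mono-≤ (All.map (ends≤adjacent x y x<y) edges-ordered) ⟩
    ∑[ f ∈ edges G ] (𝟙 (adjacentᵇ G (x , y) f) + 2 * 𝟙 (is-xy f))
      ≡⟨ ∑-+ (edges G) (𝟙 ∘ adjacentᵇ G (x , y)) (λ f → 2 * 𝟙 (is-xy f)) ⟩
    (∑[ f ∈ edges G ] 𝟙 (adjacentᵇ G (x , y) f)) + (∑[ f ∈ edges G ] 2 * 𝟙 (is-xy f))
      ≡⟨ cong₂ _+_ (sym (length-filterᵇ (adjacentᵇ G (x , y)) (edges G))) (∑-*ˡ 2 (edges G) (𝟙 ∘ is-xy)) ⟩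
    length (adjacentEdges G (x , y)) + 2 * (∑[ f ∈ edges G ] 𝟙 (is-xy f))
      ≤⟨ +-monoʳ-≤ _ (*-monoʳ-≤ 2 (∑-𝟙-unique is-xy is-xy-unique edges-unique)) ⟩
    length (adjacentEdges G (x , y)) + 2 ∎
    where
    open ≤-Reasoning
    is-xy : Edge → Bool
    is-xy f = (x == proj₁ f) ∧ (y == proj₂ f)
    is-xy⇒≡ : ∀ f → is-xy f ≡ true → f ≡ (x , y)
    is-xy⇒≡ (u , w) with x Fin.≟ u | y Fin.≟ w
    ... | yes refl | yes refl = λ _ → refl
    ... | yes _    | no _     = λ ()
    ... | no _     | _        = λ ()
    is-xy-unique : ∀ {f g} → is-xy f ≡ true → is-xy g ≡ true → f ≡ g
    is-xy-unique {f} {g} f≡xy g≡xy = trans (is-xy⇒≡ f f≡xy) (sym (is-xy⇒≡ g g≡xy))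

  adjacent-in-colourClass : ∀ {k} (c : Edge → Fin k) α x y →
    length (filterᵇ (λ f → c f == α) (adjacentEdges G (x , y)))
      ≤ deg x (colourClass c α (edges G)) + deg y (colourClass c α (edges G))
  adjacent-in-colourClass c α x y = begin
    length (filterᵇ (λ f → c f == α) (adjacentEdges G (x , y)))
      ≡⟨ cong length (filterᵇ-comm (λ f → c f == α) (adjacentᵇ G (x , y)) (edges G)) ⟩
    length (filterᵇ (adjacentᵇ G (x , y)) (colourClass c α (edges G)))
      ≡⟨ length-filterᵇ (adjacentᵇ G (x , y)) (colourClass c α (edges G)) ⟩
    ∑[ f ∈ colourClass c α (edges G) ] 𝟙 (adjacentᵇ G (x , y) f)
      ≤⟨ ∑-mono-≤ (All.universal adjacent≤ends (colourClass c α (edges G))) ⟩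
    ∑[ f ∈ colourClass c α (edges G) ] (ends x f + ends y f)
      ≡⟨ ∑-+ (colourClass c α (edges G)) (ends x) (ends y) ⟩
    deg x (colourClass c α (edges G)) + deg y (colourClass c α (edges G)) ∎
    where
    open ≤-Reasoning
    adjacent≤ends : ∀ f → 𝟙 (adjacentᵇ G (x , y) f) ≤ ends x f + ends y f
    adjacent≤ends (u , w) = 𝟙-adjacent ((x == u) ∧ (y == w)) (x == u) (x == w) (y == u) (y == w)

theorem11 : (G : Graph) → MinDegreeAtLeast G 7 → MajIndexAtMost G 4
theorem11 G δ≥7 = (λ x y → c (x , y)) , strong-majority
  where
  open EdgeCounting G
  colouring : ∃[ c ] All (EquitableAt 6 c (edges G)) (allFin (n G))
  colouring = four-colouring (allFin (n G)) (edges G) edges-unique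
  c : Edge → Fin 4
  c = proj₁ colouring
  deg[_] : Fin 4 → Fin (n G) → ℕ
  deg[ α ] v = deg v (colourClass c α (edges G))
  colour-minority : ∀ v α → 2 * deg[ α ] v < deg v (edges G)
  colour-minority v α =
    4*≤+6⇒2*< (deg[ α ] v) (All.lookup (proj₂ colouring) (∈-allFin v) α) (≤-trans (δ≥7 v) (degree≤deg v))
  strong-majority : IsStrongMajority G (λ x y → c (x , y))
  strong-majority x y _ x<y α =
    2*≤-from-halves (deg[ α ] x) (deg[ α ] y) (adjacent-in-colourClass c α x y)
                     (colour-minority x α) (colour-minority y α) (deg+deg≤adjacent x y x<y)
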